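{- Let $r\geq 2$, let $t\geq 0$ be an integer, let $n\geq (t+3)r-\lceil (t+2)/2\rceil$ (with $n\geq 2r+1$), and let $k=\binom{n-r}{r}-t$. Then $\gamma_{\times k}(K(n,r))=\binom{n}{r}-(t+1)$. Moreover, for every set $S$ of vertices of $K(n,r)$ with $|S|=t+1$, the set $V(K(n,r))\setminus S$ is a $k$-tuple dominating set of $K(n,r)$ of cardinality $\gamma_{\times k}(K(n,r))$.
   Context: The Kneser graph $K(n,r)$ has as vertices the $r$-subsets of $[n]=\{1,\dots,n\}$, two vertices adjacent iff disjoint. For a vertex $v$, $N[v]$ is its closed neighbourhood. A set $D$ of vertices is a $k$-tuple dominating set if $|N[v]\cap D|\geq k$ for every vertex $v$; $\gamma_{\times k}(K(n,r))$ is the minimum cardinality of such a set. -}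

module Defs where

open import Data.Nat using (ℕ; _≥_)
open import Data.Bool using (Bool) renaming (_≟_ to _≟ᵇ_)
open import Data.Fin.Subset using (Subset; _∩_; ⊥; ∣_∣)
open import Data.Vec.Properties using (≡-dec)
open import Data.List using (List; length; filter)
open import Data.Sum using (_⊎_)
open import Relation.Nullary using (Dec)
open import Relation.Nullary.Decidable using (_⊎-dec_)
open import Relation.Binary.PropositionalEquality using (_≡_)

IsVertex : ∀ {n} → ℕ → Subset n → Set
IsVertex r v = ∣ v ∣ ≡ r

-- adjacency in K(n,r): disjointness
Disjoint : ∀ {n} → Subset n → Subset n → Set
Disjoint u v = u ∩ v ≡ ⊥

_≟ˢ_ : ∀ {n} (u v : Subset n) → Dec (u ≡ v)
_≟ˢ_ = ≡-dec _≟ᵇ_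

disjoint? : ∀ {n} (u v : Subset n) → Dec (Disjoint u v)
disjoint? u v = (u ∩ v) ≟ˢ ⊥

InClosedNbhd : ∀ {n} → Subset n → Subset n → Set
InClosedNbhd v u = (u ≡ v) ⊎ Disjoint u v

inClosedNbhd? : ∀ {n} (v u : Subset n) → Dec (InClosedNbhd v u)
inClosedNbhd? v u = (u ≟ˢ v) ⊎-dec disjoint? u v

nbhdCount : ∀ {n} → Subset n → List (Subset n) → ℕ
nbhdCount v D = length (filter (inClosedNbhd? v) D)

-- A set of vertices of K(n,r), represented as a duplicate-free list of r-subsets.
open import Data.List.Relation.Unary.Unique.Propositional using (Unique)
open import Data.List.Relation.Unary.All using (All)
open import Data.Product using (_×_)

IsVertexSet : (n r : ℕ) → List (Subset n) → Set
IsVertexSet n r D = Unique D × All (IsVertex r) D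

IsKTupleDom : (n r k : ℕ) → List (Subset n) → Set
IsKTupleDom n r k D =
  IsVertexSet n r D × (∀ (v : Subset n) → IsVertex r v → nbhdCount v D ≥ k)

-- Every vertex v of K(n,r) has |N[v]| = 1 + C(n-r,r), and the complement of any t+1 vertices
-- misses at most t+1 vertices of each closed neighbourhood, so it is a k-tuple dominating set.
-- Conversely, a k-tuple dominating set D cannot miss t+2 vertices S: a closed neighbourhood
-- containing S would meet D in fewer than k vertices, and under the hypothesis on n any t+2
-- vertices lie in a common closed neighbourhood. Either some member of S has all of S in its
-- closed neighbourhood, or every member meets another one; then a double count over the points
-- of [n] shows that S covers at most |S|r - |S|/2 points, leaving room for an r-set disjoint
-- from all of S.
module Submission where

open import Defs
open import Data.Bool using (Bool; true; false; _∧_; _∨_; if_then_else_)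
open import Data.Bool.Properties using (∧-zeroʳ; ∧-identityʳ)
open import Data.Empty using (⊥-elim)
open import Data.Fin.Subset using (Subset; ⊥; ∣_∣)
open import Data.Fin.Subset.Properties using (∣p∣≤n; ∣⊥∣≡0; ∩-idem; ∩-zeroʳ)
open import Data.List using (List; []; _∷_; length; map; _++_; filter; take)
open import Data.List.Membership.Propositional using (_∈_; _∉_; lose; find)
open import Data.List.Membership.Propositional.Properties
  using (∈-++⁺ˡ; ∈-++⁺ʳ; ∈-++⁻; ∈-map⁺; ∈-map⁻; ∈-filter⁺; ∈-filter⁻; ∈-∃++)
import Data.List.Membership.DecPropositional as DecMembership
open import Data.List.Properties using (length-++; length-map; map-++; length-take)
import Data.List.Relation.Binary.Sublist.Propositional as Sublist
open import Data.List.Relation.Binary.Sublist.Propositional.Properties using (take-⊆)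
open import Data.List.Relation.Binary.Subset.Propositional using (_⊆_)
open import Data.List.Relation.Unary.All as All using (All; []; _∷_)
open import Data.List.Relation.Unary.All.Properties as AllP using (¬All⇒Any¬; all-filter)
open import Data.List.Relation.Unary.Any using (here; there; any?)
open import Data.List.Relation.Unary.Unique.Propositional using (Unique; []; _∷_)
import Data.List.Relation.Unary.Unique.Propositional.Properties as UniqueP
open import Data.Nat using (ℕ; zero; suc; _+_; _*_; _∸_; _≥_; _≤_; _<_; z≤n; s≤s; s≤s⁻¹; ⌈_/2⌉; _≤?_)
open import Data.Nat.Combinatorics using (_C_; nCk+nC[k+1]≡[n+1]C[k+1]; nC1≡n)
open import Data.Nat.Properties
open import Data.Nat.Solver using (module +-*-Solver)
open import Data.Product using (_×_; _,_; ∃; proj₁; proj₂; uncurry)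
open import Data.Sum using (inj₁; inj₂)
open import Data.Vec using (_∷_; []; head; tail)
open import Data.Vec.Properties using (∷-injectiveʳ)
open import Function using (_∘_)
open import Function.Bundles using (_⇔_; mk⇔; Equivalence)
open import Relation.Binary.Definitions using (DecidableEquality)
open import Relation.Binary.PropositionalEquality
open import Relation.Nullary using (Dec; yes; no; does; ¬_; ¬?; contradiction)
open import Relation.Nullary.Decidable using (dec-true; dec-false)
open import Relation.Unary using (Decidable)
open +-*-Solver

private variable
  A B : Set

-- Counting and summing over lists

countᵇ : (A → Bool) → List A → ℕ
countᵇ f []       = 0
countᵇ f (x ∷ xs) = if f x then suc (countᵇ f xs) else countᵇ f xs

length-filter≡countᵇ : ∀ {P : A → Set} (P? : Decidable P) xs →
                       length (filter P? xs) ≡ countᵇ (does ∘ P?) xs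
length-filter≡countᵇ P? []       = refl
length-filter≡countᵇ P? (x ∷ xs) with does (P? x)
... | true  = cong suc (length-filter≡countᵇ P? xs)
... | false = length-filter≡countᵇ P? xs

countᵇ-++ : ∀ (f : A → Bool) xs ys → countᵇ f (xs ++ ys) ≡ countᵇ f xs + countᵇ f ys
countᵇ-++ f []       ys = refl
countᵇ-++ f (x ∷ xs) ys with f x
... | true  = cong suc (countᵇ-++ f xs ys)
... | false = countᵇ-++ f xs ys

countᵇ-map : ∀ (f : A → Bool) (g : B → A) xs → countᵇ f (map g xs) ≡ countᵇ (f ∘ g) xs
countᵇ-map f g []       = refl
countᵇ-map f g (x ∷ xs) with f (g x)
... | true  = cong suc (countᵇ-map f g xs)
... | false = countᵇ-map f g xs

countᵇ-none : ∀ {f : A → Bool} {xs} → All (λ x → f x ≡ false) xs → countᵇ f xs ≡ 0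
countᵇ-none                []                     = refl
countᵇ-none {xs = x ∷ _} (fx≡false ∷ fxs≡false) rewrite fx≡false = countᵇ-none fxs≡false

countᵇ≡0⇒none : ∀ (f : A → Bool) xs → countᵇ f xs ≡ 0 → All (λ x → f x ≡ false) xs
countᵇ≡0⇒none f []       _ = []
countᵇ≡0⇒none f (x ∷ xs) c≡0 with f x in fx≡false
... | false = fx≡false ∷ countᵇ≡0⇒none f xs c≡0

countᵇ-pos : ∀ (f : A → Bool) {x xs} → x ∈ xs → f x ≡ true → 1 ≤ countᵇ f xs
countᵇ-pos f {xs = y ∷ xs} (here refl) fx≡true rewrite fx≡true = s≤s z≤n
countᵇ-pos f {xs = y ∷ xs} (there x∈xs) fx≡true with f y
... | true  = s≤s z≤n
... | false = countᵇ-pos f x∈xs fx≡true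

countᵇ-middle : ∀ (f : A → Bool) {x} P Q → f x ≡ true → countᵇ f (P ++ x ∷ Q) ≡ suc (countᵇ f (P ++ Q))
countᵇ-middle f []      Q fx≡true rewrite fx≡true = refl
countᵇ-middle f (y ∷ P) Q fx≡true with f y
... | true  = cong suc (countᵇ-middle f P Q fx≡true)
... | false = countᵇ-middle f P Q fx≡true

countᵇ-∨ : ∀ (f g : A → Bool) → (∀ x → f x ∧ g x ≡ false) → ∀ xs →
           countᵇ (λ x → f x ∨ g x) xs ≡ countᵇ f xs + countᵇ g xs
countᵇ-∨ f g exclusive []       = refl
countᵇ-∨ f g exclusive (x ∷ xs) with f x | g x | exclusive x
... | true  | false | _ = cong suc (countᵇ-∨ f g exclusive xs)
... | false | true  | _ = trans (cong suc (countᵇ-∨ f g exclusive xs)) (sym (+-suc _ _))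
... | false | false | _ = countᵇ-∨ f g exclusive xs

countᵇ-≟-unique : (_≟_ : DecidableEquality A) → ∀ {x xs} → Unique xs → x ∈ xs →
                  countᵇ (λ y → does (y ≟ x)) xs ≡ 1
countᵇ-≟-unique _≟_ {x} (x∉xs ∷ _) (here refl) rewrite dec-true (x ≟ x) refl =
  cong suc (countᵇ-none (All.map (λ x≢y → dec-false (_ ≟ x) (x≢y ∘ sym)) x∉xs))
countᵇ-≟-unique _≟_ {x} {y ∷ _} (y∉xs ∷ xs-unique) (there x∈xs)
  rewrite dec-false (y ≟ x) (All.lookup y∉xs x∈xs) = countᵇ-≟-unique _≟_ xs-unique x∈xs

sumBy : (A → ℕ) → List A → ℕ
sumBy f []       = 0
sumBy f (x ∷ xs) = f x + sumBy f xs

sumBy-cong : ∀ {f g : A → ℕ} → (∀ x → f x ≡ g x) → ∀ xs → sumBy f xs ≡ sumBy g xs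
sumBy-cong f≗g []       = refl
sumBy-cong f≗g (x ∷ xs) = cong₂ _+_ (f≗g x) (sumBy-cong f≗g xs)

sumBy-+ : ∀ (f g : A → ℕ) xs → sumBy (λ x → f x + g x) xs ≡ sumBy f xs + sumBy g xs
sumBy-+ f g []       = refl
sumBy-+ f g (x ∷ xs) rewrite sumBy-+ f g xs =
  solve 4 (λ a b c d → (a :+ b) :+ (c :+ d) := (a :+ c) :+ (b :+ d)) refl
    (f x) (g x) (sumBy f xs) (sumBy g xs)

sumBy-map : ∀ (f : A → ℕ) (g : B → A) xs → sumBy f (map g xs) ≡ sumBy (f ∘ g) xs
sumBy-map f g []       = refl
sumBy-map f g (x ∷ xs) = cong (f (g x) +_) (sumBy-map f g xs)

sumBy-if : ∀ (f : A → Bool) m xs → sumBy (λ x → if f x then m else 0) xs ≡ countᵇ f xs * m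
sumBy-if f m []       = refl
sumBy-if f m (x ∷ xs) with f x
... | true  = cong (m +_) (sumBy-if f m xs)
... | false = sumBy-if f m xs

sumBy-const : ∀ {f : A → ℕ} {m xs} → All (λ x → f x ≡ m) xs → sumBy f xs ≡ length xs * m
sumBy-const []             = refl
sumBy-const (fx≡m ∷ f≡m) = cong₂ _+_ fx≡m (sumBy-const f≡m)

length≤sumBy : ∀ {f : A → ℕ} {xs} → All (λ x → 1 ≤ f x) xs → length xs ≤ sumBy f xs
length≤sumBy []             = z≤n
length≤sumBy (1≤fx ∷ 1≤fxs) = +-mono-≤ 1≤fx (length≤sumBy 1≤fxs)

∈-++∷⁻ : ∀ {x y : A} P Q → y ∈ P ++ x ∷ Q → y ≢ x → y ∈ P ++ Q
∈-++∷⁻ P Q y∈ y≢x with ∈-++⁻ P y∈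
... | inj₁ y∈P         = ∈-++⁺ˡ y∈P
... | inj₂ (here y≡x)  = ⊥-elim (y≢x y≡x)
... | inj₂ (there y∈Q) = ∈-++⁺ʳ P y∈Q

Unique-⊆⇒length≤ : ∀ {xs ys : List A} → Unique xs → xs ⊆ ys → length xs ≤ length ys
Unique-⊆⇒length≤ {xs = []}     _              _  = z≤n
Unique-⊆⇒length≤ {xs = x ∷ xs} (x∉xs ∷ xs-unique) xs⊆ys with ∈-∃++ (xs⊆ys (here refl))
... | P , Q , refl = begin
  suc (length xs)         ≤⟨ s≤s (Unique-⊆⇒length≤ xs-unique xs⊆P++Q) ⟩
  suc (length (P ++ Q))   ≡⟨ cong suc (length-++ P) ⟩
  suc (length P + length Q) ≡⟨ +-suc (length P) (length Q) ⟨
  length P + length (x ∷ Q) ≡⟨ length-++ P ⟨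
  length (P ++ x ∷ Q)     ∎
  where
  open ≤-Reasoning
  xs⊆P++Q : xs ⊆ P ++ Q
  xs⊆P++Q y∈xs = ∈-++∷⁻ P Q (xs⊆ys (there y∈xs)) (λ y≡x → All.lookup x∉xs y∈xs (sym y≡x))

∈-take : ∀ {x : A} k xs → x ∈ take k xs → x ∈ xs
∈-take k xs = Sublist.lookup (take-⊆ k xs)

-- The vertices of K(n,r)

vertices : (n r : ℕ) → List (Subset n)
vertices zero    zero    = [] ∷ []
vertices zero    (suc r) = []
vertices (suc n) zero    = map (false ∷_) (vertices n zero)
vertices (suc n) (suc r) = map (true ∷_) (vertices n r) ++ map (false ∷_) (vertices n (suc r))

length-vertices : ∀ n r → length (vertices n r) ≡ n C r
length-vertices zero    zero    = refl
length-vertices zero    (suc r) = refl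
length-vertices (suc n) zero    = trans (length-map _ (vertices n zero)) (length-vertices n zero)
length-vertices (suc n) (suc r) = begin
  length (map (true ∷_) (vertices n r) ++ map (false ∷_) (vertices n (suc r)))
    ≡⟨ length-++ (map (true ∷_) (vertices n r)) ⟩
  length (map (true ∷_) (vertices n r)) + length (map (false ∷_) (vertices n (suc r)))
    ≡⟨ cong₂ _+_ (length-map _ (vertices n r)) (length-map _ (vertices n (suc r))) ⟩
  length (vertices n r) + length (vertices n (suc r))
    ≡⟨ cong₂ _+_ (length-vertices n r) (length-vertices n (suc r)) ⟩
  n C r + n C suc r
    ≡⟨ nCk+nC[k+1]≡[n+1]C[k+1] n r ⟩
  suc n C suc r ∎
  where open ≡-Reasoning

∈-vertices⁻ : ∀ {n r u} → u ∈ vertices n r → IsVertex r u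
∈-vertices⁻ {zero}  {zero}  (here refl) = refl
∈-vertices⁻ {suc n} {zero}  u∈ with ∈-map⁻ (false ∷_) u∈
... | _ , u′∈ , refl = ∈-vertices⁻ u′∈
∈-vertices⁻ {suc n} {suc r} u∈ with ∈-++⁻ (map (true ∷_) (vertices n r)) u∈
... | inj₁ u∈₁ with ∈-map⁻ (true ∷_) u∈₁
...   | _ , u′∈ , refl = cong suc (∈-vertices⁻ u′∈)
∈-vertices⁻ {suc n} {suc r} u∈ | inj₂ u∈₂ with ∈-map⁻ (false ∷_) u∈₂
...   | _ , u′∈ , refl = ∈-vertices⁻ u′∈

∈-vertices⁺ : ∀ {n r} (u : Subset n) → IsVertex r u → u ∈ vertices n r
∈-vertices⁺ {zero}  {zero}  []          _     = here refl
∈-vertices⁺ {suc n} {zero}  (false ∷ u) |u|≡0 = ∈-map⁺ (false ∷_) (∈-vertices⁺ u |u|≡0)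
∈-vertices⁺ {suc n} {suc r} (true ∷ u)  |u|≡r =
  ∈-++⁺ˡ (∈-map⁺ (true ∷_) (∈-vertices⁺ u (suc-injective |u|≡r)))
∈-vertices⁺ {suc n} {suc r} (false ∷ u) |u|≡r =
  ∈-++⁺ʳ (map (true ∷_) (vertices n r)) (∈-map⁺ (false ∷_) (∈-vertices⁺ u |u|≡r))

vertices-unique : ∀ n r → Unique (vertices n r)
vertices-unique zero    zero    = [] ∷ []
vertices-unique zero    (suc r) = []
vertices-unique (suc n) zero    = UniqueP.map⁺ ∷-injectiveʳ (vertices-unique n zero)
vertices-unique (suc n) (suc r) =
  UniqueP.++⁺ (UniqueP.map⁺ ∷-injectiveʳ (vertices-unique n r))
              (UniqueP.map⁺ ∷-injectiveʳ (vertices-unique n (suc r)))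
              first-point-differs
  where
  first-point-differs : ∀ {v} →
    ¬ (v ∈ map (true ∷_) (vertices n r) × v ∈ map (false ∷_) (vertices n (suc r)))
  first-point-differs (v∈₁ , v∈₂) with ∈-map⁻ (true ∷_) v∈₁ | ∈-map⁻ (false ∷_) v∈₂
  ... | _ , _ , refl | _ , _ , ()

vertices-vertexSet : ∀ n r → IsVertexSet n r (vertices n r)
vertices-vertexSet n r = vertices-unique n r , All.tabulate ∈-vertices⁻

countᵇ-vertices : ∀ {n r} (f : Subset (suc n) → Bool) →
  countᵇ f (vertices (suc n) (suc r)) ≡
  countᵇ (f ∘ (true ∷_)) (vertices n r) + countᵇ (f ∘ (false ∷_)) (vertices n (suc r))
countᵇ-vertices {n} {r} f = trans (countᵇ-++ f (map (true ∷_) (vertices n r)) _)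
  (cong₂ _+_ (countᵇ-map f _ (vertices n r)) (countᵇ-map f _ (vertices n (suc r))))

count-disjoint-vertices : ∀ n r (v : Subset n) →
  countᵇ (λ u → does (disjoint? u v)) (vertices n r) ≡ (n ∸ ∣ v ∣) C r
count-disjoint-vertices zero    zero    []          = refl
count-disjoint-vertices zero    (suc r) []          = refl
count-disjoint-vertices (suc n) zero    (b ∷ v)     =
  trans (countᵇ-map _ (false ∷_) (vertices n zero)) (count-disjoint-vertices n zero v)
count-disjoint-vertices (suc n) (suc r) (true ∷ v)  =
  trans (countᵇ-vertices {n} {r} (λ u → does (disjoint? u (true ∷ v))))
    (cong₂ _+_ (countᵇ-none {xs = vertices n r} (All.tabulate (λ _ → refl)))
               (count-disjoint-vertices n (suc r) v))
count-disjoint-vertices (suc n) (suc r) (false ∷ v) = begin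
  countᵇ (λ u → does (disjoint? u (false ∷ v))) (vertices (suc n) (suc r))
    ≡⟨ countᵇ-vertices {n} {r} (λ u → does (disjoint? u (false ∷ v))) ⟩
  countᵇ (λ u → does (disjoint? u v)) (vertices n r) + countᵇ (λ u → does (disjoint? u v)) (vertices n (suc r))
    ≡⟨ cong₂ _+_ (count-disjoint-vertices n r v) (count-disjoint-vertices n (suc r) v) ⟩
  (n ∸ ∣ v ∣) C r + (n ∸ ∣ v ∣) C suc r
    ≡⟨ nCk+nC[k+1]≡[n+1]C[k+1] (n ∸ ∣ v ∣) r ⟩
  suc (n ∸ ∣ v ∣) C suc r
    ≡⟨ cong (_C suc r) (+-∸-assoc 1 (∣p∣≤n v)) ⟨
  (suc n ∸ ∣ v ∣) C suc r ∎
  where open ≡-Reasoning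

¬Disjoint-self : ∀ {n} {v : Subset n} → 1 ≤ ∣ v ∣ → ¬ Disjoint v v
¬Disjoint-self {n} {v} |v|≥1 v∩v≡⊥ =
  <⇒≢ |v|≥1 (sym (trans (cong ∣_∣ (trans (sym (∩-idem v)) v∩v≡⊥)) (∣⊥∣≡0 n)))

closedNbhd-count : ∀ {n r} (v : Subset n) → 1 ≤ r → IsVertex r v →
  nbhdCount v (vertices n r) ≡ suc ((n ∸ r) C r)
closedNbhd-count {n} v |v|≥1 refl = begin
  nbhdCount v (vertices n ∣ v ∣)
    ≡⟨ length-filter≡countᵇ (inClosedNbhd? v) (vertices n ∣ v ∣) ⟩
  countᵇ (λ u → does (u ≟ˢ v) ∨ does (disjoint? u v)) (vertices n ∣ v ∣)
    ≡⟨ countᵇ-∨ _ _ equal-or-disjoint (vertices n ∣ v ∣) ⟩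
  countᵇ (λ u → does (u ≟ˢ v)) (vertices n ∣ v ∣) + countᵇ (λ u → does (disjoint? u v)) (vertices n ∣ v ∣)
    ≡⟨ cong₂ _+_ (countᵇ-≟-unique _≟ˢ_ (vertices-unique n _) (∈-vertices⁺ v refl))
                 (count-disjoint-vertices n _ v) ⟩
  suc ((n ∸ ∣ v ∣) C ∣ v ∣) ∎
  where
  open ≡-Reasoning
  equal-or-disjoint : ∀ u → does (u ≟ˢ v) ∧ does (disjoint? u v) ≡ false
  equal-or-disjoint u with u ≟ˢ v
  ... | yes refl = dec-false (disjoint? u u) (¬Disjoint-self |v|≥1)
  ... | no  _    = refl

vertexSet-length≤ : ∀ {n r xs} → IsVertexSet n r xs → length xs ≤ n C r
vertexSet-length≤ {n} {r} (xs-unique , xs-vertices) =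
  subst (_ ≤_) (length-vertices n r)
    (Unique-⊆⇒length≤ xs-unique (λ u∈ → ∈-vertices⁺ _ (All.lookup xs-vertices u∈)))

vertices-length≥ : ∀ {n r xs} → (∀ {u} → IsVertex r u → u ∈ xs) → n C r ≤ length xs
vertices-length≥ {n} {r} covers =
  subst (_≤ _) (length-vertices n r)
    (Unique-⊆⇒length≤ (vertices-unique n r) (covers ∘ ∈-vertices⁻))

closedNbhd-length≤ : ∀ {n r xs} {v : Subset n} → 1 ≤ r → IsVertex r v →
  IsVertexSet n r xs → All (InClosedNbhd v) xs → length xs ≤ suc ((n ∸ r) C r)
closedNbhd-length≤ {n} {r} {v = v} r≥1 v-vertex (xs-unique , xs-vertices) xs-near =
  subst (_ ≤_) (closedNbhd-count v r≥1 v-vertex)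
    (Unique-⊆⇒length≤ xs-unique (λ u∈ →
      ∈-filter⁺ (inClosedNbhd? v) (∈-vertices⁺ _ (All.lookup xs-vertices u∈)) (All.lookup xs-near u∈)))

closedNbhd-length≥ : ∀ {n r xs} {v : Subset n} → 1 ≤ r → IsVertex r v →
  (∀ {u} → IsVertex r u → InClosedNbhd v u → u ∈ xs) → suc ((n ∸ r) C r) ≤ length xs
closedNbhd-length≥ {n} {r} {v = v} r≥1 v-vertex covers =
  subst (_≤ _) (closedNbhd-count v r≥1 v-vertex)
    (Unique-⊆⇒length≤ (UniqueP.filter⁺ (inClosedNbhd? v) (vertices-unique n r)) (λ u∈ →
      let u∈V , u-near = ∈-filter⁻ (inClosedNbhd? v) u∈ in covers (∈-vertices⁻ u∈V) u-near))

-- Double counting over the points of [n]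

columnCount : ∀ {n} → List (Subset (suc n)) → ℕ
columnCount = countᵇ head

atLeast1 : ℕ → ℕ
atLeast1 zero    = 0
atLeast1 (suc _) = 1

atLeast2 : ℕ → ℕ
atLeast2 (suc (suc _)) = 1
atLeast2 _             = 0

-- coverSize L = |⋃ L| and multiplyCovered L A = #{x ∈ A : x lies in at least two members of L},
-- both computed one coordinate at a time.
coverSize : ∀ {n} → List (Subset n) → ℕ
coverSize {zero}  L = 0
coverSize {suc n} L = atLeast1 (columnCount L) + coverSize (map tail L)

multiplyCovered : ∀ {n} → List (Subset n) → Subset n → ℕ
multiplyCovered {zero}  L A       = 0
multiplyCovered {suc n} L (a ∷ A) =
  (if a then atLeast2 (columnCount L) else 0) + multiplyCovered (map tail L) A

column-inequality : ∀ c → c * atLeast2 c + 2 * atLeast1 c ≤ 2 * c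
column-inequality zero          = z≤n
column-inequality (suc zero)    = ≤-refl
column-inequality (suc (suc k)) = begin
  (2 + k) * 1 + 2 * 1 ≡⟨ solve 1 (λ k → (con 2 :+ k) :* con 1 :+ con 2 :* con 1 := k :+ con 4) refl k ⟩
  k + 4               ≤⟨ m≤m+n (k + 4) k ⟩
  k + 4 + k           ≡⟨ solve 1 (λ k → k :+ con 4 :+ k := con 2 :* (con 2 :+ k)) refl k ⟩
  2 * (2 + k)         ∎
  where open ≤-Reasoning

sumBy-column : ∀ {n} (f : Subset (suc n) → ℕ) (g : Subset n → ℕ) k →
  (∀ a A → f (a ∷ A) ≡ (if a then k else 0) + g A) → ∀ L →
  sumBy f L ≡ columnCount L * k + sumBy g (map tail L)
sumBy-column f g k f-split L = begin
  sumBy f L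
    ≡⟨ sumBy-cong (λ { (a ∷ A) → f-split a A }) L ⟩
  sumBy (λ A → (if head A then k else 0) + g (tail A)) L
    ≡⟨ sumBy-+ _ _ L ⟩
  sumBy (λ A → if head A then k else 0) L + sumBy (g ∘ tail) L
    ≡⟨ cong₂ _+_ (sumBy-if head k L) (sym (sumBy-map g tail L)) ⟩
  columnCount L * k + sumBy g (map tail L) ∎
  where open ≡-Reasoning

multiplyCovered-double-count : ∀ {n} (L : List (Subset n)) →
  sumBy (multiplyCovered L) L + 2 * coverSize L ≤ 2 * sumBy ∣_∣ L
multiplyCovered-double-count {zero} L
  rewrite sumBy-const {f = multiplyCovered L} {m = 0} {xs = L} (All.tabulate (λ _ → refl)) | *-zeroʳ (length L)
  = z≤n
multiplyCovered-double-count {suc n} L = begin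
  sumBy (multiplyCovered L) L + 2 * coverSize L
    ≡⟨ cong (_+ 2 * coverSize L)
         (sumBy-column (multiplyCovered L) (multiplyCovered L′) (atLeast2 c) (λ _ _ → refl) L) ⟩
  (c * atLeast2 c + sumBy (multiplyCovered L′) L′) + 2 * (atLeast1 c + coverSize L′)
    ≡⟨ solve 4 (λ p X q U → (p :+ X) :+ con 2 :* (q :+ U) := (p :+ con 2 :* q) :+ (X :+ con 2 :* U)) refl
         (c * atLeast2 c) (sumBy (multiplyCovered L′) L′) (atLeast1 c) (coverSize L′) ⟩
  (c * atLeast2 c + 2 * atLeast1 c) + (sumBy (multiplyCovered L′) L′ + 2 * coverSize L′)
    ≤⟨ +-mono-≤ (column-inequality c) (multiplyCovered-double-count L′) ⟩
  2 * c + 2 * sumBy ∣_∣ L′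
    ≡⟨ *-distribˡ-+ 2 c (sumBy ∣_∣ L′) ⟨
  2 * (c + sumBy ∣_∣ L′)
    ≡⟨ cong (2 *_) (trans (sumBy-column ∣_∣ ∣_∣ 1 size-split L)
                          (cong (_+ sumBy ∣_∣ L′) (*-identityʳ c))) ⟨
  2 * sumBy ∣_∣ L ∎
  where
  open ≤-Reasoning
  c : ℕ
  c = columnCount L
  L′ : List (Subset n)
  L′ = map tail L
  size-split : ∀ a (A : Subset n) → ∣ a ∷ A ∣ ≡ (if a then 1 else 0) + ∣ A ∣
  size-split true  A = refl
  size-split false A = refl

Disjoint-∷ : ∀ {n} a b {u v : Subset n} → a ∧ b ≡ false → Disjoint u v → Disjoint (a ∷ u) (b ∷ v)
Disjoint-∷ a b = cong₂ _∷_

∈-map-tail : ∀ {n} (P Q : List (Subset (suc n))) {b u} → (b ∷ u) ∈ P ++ Q → u ∈ map tail P ++ map tail Q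
∈-map-tail P Q bu∈ = subst (_ ∈_) (map-++ tail P Q) (∈-map⁺ tail bu∈)

multiplyCovered-tail : ∀ {n} (P Q : List (Subset (suc n))) a A →
  multiplyCovered (map tail P ++ A ∷ map tail Q) A ≤ multiplyCovered (P ++ (a ∷ A) ∷ Q) (a ∷ A)
multiplyCovered-tail P Q a A =
  ≤-trans (≤-reflexive (cong (λ L → multiplyCovered L A) (sym (map-++ tail P ((a ∷ A) ∷ Q))))) (m≤n+m _ _)

multiplyCovered-pos : ∀ {n} (P Q : List (Subset n)) {A u} →
  u ∈ P ++ Q → ¬ Disjoint u A → 1 ≤ multiplyCovered (P ++ A ∷ Q) A
multiplyCovered-pos {zero}  P Q {[]}       {[]}       _  meets = contradiction refl meets
multiplyCovered-pos {suc n} P Q {true ∷ A} {true ∷ u} u∈ _     = ≤-trans (atLeast2-pos shared) (m≤m+n _ _)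
  where
  atLeast2-pos : ∀ {c} → 2 ≤ c → 1 ≤ atLeast2 c
  atLeast2-pos (s≤s (s≤s _)) = s≤s z≤n
  shared : 2 ≤ columnCount (P ++ (true ∷ A) ∷ Q)
  shared = subst (2 ≤_) (sym (countᵇ-middle head P Q refl)) (s≤s (countᵇ-pos head u∈ refl))
multiplyCovered-pos {suc n} P Q {true ∷ A} {false ∷ u} u∈ meets =
  ≤-trans (multiplyCovered-pos (map tail P) (map tail Q) (∈-map-tail P Q u∈)
                               (meets ∘ Disjoint-∷ false true refl))
          (multiplyCovered-tail P Q true A)
multiplyCovered-pos {suc n} P Q {false ∷ A} {b ∷ u} u∈ meets =
  ≤-trans (multiplyCovered-pos (map tail P) (map tail Q) (∈-map-tail P Q u∈)
                               (meets ∘ Disjoint-∷ b false (∧-zeroʳ b)))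
          (multiplyCovered-tail P Q false A)

disjoint-vertex : ∀ {n} r (L : List (Subset n)) → coverSize L + r ≤ n →
  ∃ λ v → IsVertex r v × All (λ u → Disjoint u v) L
disjoint-vertex {n}     zero    L _ = ⊥ , ∣⊥∣≡0 n , All.tabulate (λ {u} _ → ∩-zeroʳ u)
disjoint-vertex {suc n} (suc r) L room with columnCount L in c≡0
... | zero with disjoint-vertex r (map tail L) (≤-pred (subst (_≤ suc n) (+-suc _ r) room))
...   | v , |v|≡r , L′-disjoint =
  true ∷ v , cong suc |v|≡r ,
  All.zipWith (λ { {b ∷ u} (b≡false , u∩v≡⊥) → Disjoint-∷ b true (trans (∧-identityʳ b) b≡false) u∩v≡⊥ })
              (countᵇ≡0⇒none head L c≡0 , AllP.map⁻ L′-disjoint)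
disjoint-vertex {suc n} (suc r) L room | suc c with disjoint-vertex (suc r) (map tail L) (≤-pred room)
... | v , |v|≡r , L′-disjoint =
  false ∷ v , |v|≡r , All.map (λ { {b ∷ u} → Disjoint-∷ b false (∧-zeroʳ b) }) (AllP.map⁻ L′-disjoint)

overlap-bound : ∀ {n} r (S : List (Subset n)) → All (IsVertex r) S →
  (∀ {A} → A ∈ S → ¬ All (InClosedNbhd A) S) → length S + 2 * coverSize S ≤ 2 * (length S * r)
overlap-bound r S S-vertices no-centre = begin
  length S + 2 * coverSize S
    ≤⟨ +-monoˡ-≤ (2 * coverSize S) (length≤sumBy (All.tabulate multiply-covered)) ⟩
  sumBy (multiplyCovered S) S + 2 * coverSize S
    ≤⟨ multiplyCovered-double-count S ⟩
  2 * sumBy ∣_∣ S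
    ≡⟨ cong (2 *_) (sumBy-const S-vertices) ⟩
  2 * (length S * r) ∎
  where
  open ≤-Reasoning
  multiply-covered : ∀ {A} → A ∈ S → 1 ≤ multiplyCovered S A
  multiply-covered {A} A∈S with find (¬All⇒Any¬ (inClosedNbhd? A) S (no-centre A∈S)) | ∈-∃++ A∈S
  ... | u , u∈S , u-far | P , Q , S≡P++A∷Q =
    subst (λ L → 1 ≤ multiplyCovered L A) (sym S≡P++A∷Q)
      (multiplyCovered-pos P Q (∈-++∷⁻ P Q (subst (u ∈_) S≡P++A∷Q u∈S) (u-far ∘ inj₁)) (u-far ∘ inj₂))

2*⌈n/2⌉≤1+n : ∀ n → 2 * ⌈ n /2⌉ ≤ suc n
2*⌈n/2⌉≤1+n zero          = z≤n
2*⌈n/2⌉≤1+n (suc zero)    = ≤-refl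
2*⌈n/2⌉≤1+n (suc (suc n)) =
  subst (_≤ suc (suc (suc n))) (sym (*-distribˡ-+ 2 1 ⌈ n /2⌉)) (s≤s (s≤s (2*⌈n/2⌉≤1+n n)))

cover-bound : ∀ m U r n → m + 2 * U ≤ 2 * (m * r) → (m + 1) * r ≤ n + ⌈ m /2⌉ → U + r ≤ n
cover-bound m U r n overlapping room = s≤s⁻¹ (*-cancelˡ-< 2 (U + r) (suc n)
  (subst (suc (2 * (U + r)) ≤_) (sym (*-suc 2 n)) (s≤s (+-cancelʳ-≤ m _ _ doubled))))
  where
  open ≤-Reasoning
  doubled : 2 * (U + r) + m ≤ suc (2 * n) + m
  doubled = begin
    2 * (U + r) + m     ≡⟨ solve 3 (λ U r m → con 2 :* (U :+ r) :+ m := (m :+ con 2 :* U) :+ con 2 :* r)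
                                 refl U r m ⟩
    m + 2 * U + 2 * r   ≤⟨ +-monoˡ-≤ (2 * r) overlapping ⟩
    2 * (m * r) + 2 * r ≡⟨ solve 2 (λ m r → con 2 :* (m :* r) :+ con 2 :* r := con 2 :* ((m :+ con 1) :* r))
                                 refl m r ⟩
    2 * ((m + 1) * r)   ≤⟨ *-monoʳ-≤ 2 room ⟩
    2 * (n + ⌈ m /2⌉)   ≡⟨ *-distribˡ-+ 2 n ⌈ m /2⌉ ⟩
    2 * n + 2 * ⌈ m /2⌉ ≤⟨ +-monoʳ-≤ (2 * n) (2*⌈n/2⌉≤1+n m) ⟩
    2 * n + suc m       ≡⟨ +-suc (2 * n) m ⟩
    suc (2 * n) + m     ∎

common-closed-neighbour : ∀ {n} r (S : List (Subset n)) → All (IsVertex r) S →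
  (length S + 1) * r ≤ n + ⌈ length S /2⌉ → ∃ λ v → IsVertex r v × All (InClosedNbhd v) S
common-closed-neighbour {n} r S S-vertices room with any? (λ A → All.all? (inClosedNbhd? A) S) S
... | yes centre with find centre
...   | A , A∈S , S-near-A = A , All.lookup S-vertices A∈S , S-near-A
common-closed-neighbour {n} r S S-vertices room | no no-centre
  with disjoint-vertex r S (cover-bound (length S) (coverSize S) r n
         (overlap-bound r S S-vertices (λ A∈S → no-centre ∘ lose A∈S)) room)
... | v , v-vertex , S-disjoint = v , v-vertex , All.map inj₂ S-disjoint

-- Dominating sets

vertexSet-take : ∀ {n r} m {xs : List (Subset n)} → IsVertexSet n r xs → m ≤ length xs →
  IsVertexSet n r (take m xs) × length (take m xs) ≡ m
vertexSet-take m {xs} (xs-unique , xs-vertices) m≤ =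
  (UniqueP.take⁺ m xs-unique , AllP.take⁺ m xs-vertices) , trans (length-take m xs) (m≤n⇒m⊓n≡m m≤)

_∈ˢ?_ : ∀ {n} (v : Subset n) (D : List (Subset n)) → Dec (v ∈ D)
_∈ˢ?_ = DecMembership._∈?_ _≟ˢ_

vertex-∈-++ : ∀ {n r} {xs ys : List (Subset n)} → (∀ {u} → IsVertex r u → u ∉ ys → u ∈ xs) →
  ∀ {u} → IsVertex r u → u ∈ xs ++ ys
vertex-∈-++ {xs = xs} {ys} covers {u} u-vertex with u ∈ˢ? ys
... | yes u∈ys = ∈-++⁺ʳ xs u∈ys
... | no  u∉ys = ∈-++⁺ˡ (covers u-vertex u∉ys)

complement : ∀ {n} r → List (Subset n) → List (Subset n)
complement {n} r D = filter (λ v → ¬? (v ∈ˢ? D)) (vertices n r)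

∈-complement⁻ : ∀ {n r D} {v : Subset n} → v ∈ complement r D → IsVertex r v × v ∉ D
∈-complement⁻ {n} {r} {D} v∈ =
  let v∈V , v∉D = ∈-filter⁻ (λ v → ¬? (v ∈ˢ? D)) {xs = vertices n r} v∈ in ∈-vertices⁻ v∈V , v∉D

∈-complement⁺ : ∀ {n r D} {v : Subset n} → IsVertex r v → v ∉ D → v ∈ complement r D
∈-complement⁺ {D = D} {v} v-vertex v∉D = ∈-filter⁺ (λ v → ¬? (v ∈ˢ? D)) (∈-vertices⁺ v v-vertex) v∉D

complement-vertexSet : ∀ {n} r (D : List (Subset n)) → IsVertexSet n r (complement r D)
complement-vertexSet {n} r D =
  UniqueP.filter⁺ (λ v → ¬? (v ∈ˢ? D)) (vertices-unique n r) , All.tabulate (proj₁ ∘ ∈-complement⁻)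

complement-isKTupleDom : ∀ {n r} t → 1 ≤ r → (S D : List (Subset n)) → IsVertexSet n r S →
  length S ≡ t + 1 → (∀ v → (v ∈ D) ⇔ (IsVertex r v × v ∉ S)) → Unique D →
  IsKTupleDom n r ((n ∸ r) C r ∸ t) D × length D ≡ n C r ∸ (t + 1)
complement-isKTupleDom {n} {r} t r≥1 S D (S-unique , S-vertices) |S| D≡V∖S D-unique =
  ((D-unique , D-vertices) , dominating) , |D|
  where
  D-vertices : All (IsVertex r) D
  D-vertices = All.tabulate (proj₁ ∘ Equivalence.to (D≡V∖S _))
  covers : ∀ {u} → IsVertex r u → u ∈ D ++ S
  covers = vertex-∈-++ (λ u-vertex u∉S → Equivalence.from (D≡V∖S _) (u-vertex , u∉S))
  D++S-vertexSet : IsVertexSet n r (D ++ S)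
  D++S-vertexSet =
    UniqueP.++⁺ D-unique S-unique (λ (u∈D , u∈S) → proj₂ (Equivalence.to (D≡V∖S _) u∈D) u∈S) ,
    AllP.++⁺ D-vertices S-vertices
  |D++S| : length (D ++ S) ≡ n C r
  |D++S| = ≤-antisym (vertexSet-length≤ D++S-vertexSet) (vertices-length≥ covers)
  |D| : length D ≡ n C r ∸ (t + 1)
  |D| = begin
    length D                      ≡⟨ m+n∸n≡m (length D) (t + 1) ⟨
    length D + (t + 1) ∸ (t + 1)  ≡⟨ cong (λ s → length D + s ∸ (t + 1)) |S| ⟨
    length D + length S ∸ (t + 1) ≡⟨ cong (_∸ (t + 1)) (length-++ D) ⟨
    length (D ++ S) ∸ (t + 1)     ≡⟨ cong (_∸ (t + 1)) |D++S| ⟩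
    n C r ∸ (t + 1)               ∎
    where open ≡-Reasoning
  dominating : ∀ v → IsVertex r v → nbhdCount v D ≥ (n ∸ r) C r ∸ t
  dominating v v-vertex = m≤n+o⇒m∸n≤o ((n ∸ r) C r) t (s≤s⁻¹ (begin
    suc ((n ∸ r) C r)                        ≤⟨ closedNbhd-length≥ r≥1 v-vertex near-covers ⟩
    length (filter (inClosedNbhd? v) D ++ S) ≡⟨ length-++ (filter (inClosedNbhd? v) D) ⟩
    nbhdCount v D + length S                 ≡⟨ cong (nbhdCount v D +_) |S| ⟩
    nbhdCount v D + (t + 1)                  ≡⟨ solve 2 (λ a t → a :+ (t :+ con 1) := con 1 :+ (t :+ a))
                                                        refl (nbhdCount v D) t ⟩
    suc (t + nbhdCount v D)                  ∎))
    where
    open ≤-Reasoning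
    near-covers : ∀ {u} → IsVertex r u → InClosedNbhd v u → u ∈ filter (inClosedNbhd? v) D ++ S
    near-covers u-vertex u-near with ∈-++⁻ D (covers u-vertex)
    ... | inj₁ u∈D = ∈-++⁺ˡ (∈-filter⁺ (inClosedNbhd? v) u∈D u-near)
    ... | inj₂ u∈S = ∈-++⁺ʳ _ u∈S

undominated-closedNbhd-length≤ : ∀ {n r} t {D S : List (Subset n)} {v} → 1 ≤ r →
  IsKTupleDom n r ((n ∸ r) C r ∸ t) D → IsVertexSet n r S → (∀ {u} → u ∈ S → u ∉ D) →
  IsVertex r v → All (InClosedNbhd v) S → length S ≤ t + 1
undominated-closedNbhd-length≤ {n} {r} t {D} {S} {v} r≥1 ((D-unique , D-vertices) , dominating)
                              (S-unique , S-vertices) S∩D≡∅ v-vertex S-near =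
  +-cancelˡ-≤ (nbhdCount v D) _ _ (begin
    nbhdCount v D + length S                 ≡⟨ length-++ (filter (inClosedNbhd? v) D) ⟨
    length (filter (inClosedNbhd? v) D ++ S) ≤⟨ closedNbhd-length≤ r≥1 v-vertex near-vertexSet near ⟩
    suc ((n ∸ r) C r)                        ≤⟨ s≤s (≤-trans (m≤n+m∸n _ t)
                                                             (+-monoʳ-≤ t (dominating v v-vertex))) ⟩
    suc (t + nbhdCount v D)                  ≡⟨ solve 2 (λ a t → con 1 :+ (t :+ a) := a :+ (t :+ con 1))
                                                        refl (nbhdCount v D) t ⟩
    nbhdCount v D + (t + 1)                  ∎)
  where
  open ≤-Reasoning
  near-vertexSet : IsVertexSet n r (filter (inClosedNbhd? v) D ++ S)
  near-vertexSet =
    UniqueP.++⁺ (UniqueP.filter⁺ (inClosedNbhd? v) D-unique) S-unique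
      (λ (u∈D′ , u∈S) → S∩D≡∅ u∈S (proj₁ (∈-filter⁻ (inClosedNbhd? v) {xs = D} u∈D′))) ,
    AllP.++⁺ (AllP.filter⁺ (inClosedNbhd? v) D-vertices) S-vertices
  near : All (InClosedNbhd v) (filter (inClosedNbhd? v) D ++ S)
  near = AllP.++⁺ (all-filter (inClosedNbhd? v) D) S-near

HasCommonClosedNeighbours : (n r m : ℕ) → Set
HasCommonClosedNeighbours n r m =
  ∀ S → IsVertexSet n r S → length S ≡ m → ∃ λ v → IsVertex r v × All (InClosedNbhd v) S

complement-length≤ : ∀ {n r} t → 1 ≤ r → HasCommonClosedNeighbours n r (t + 2) →
  ∀ {D} → IsKTupleDom n r ((n ∸ r) C r ∸ t) D → length (complement r D) ≤ t + 1
complement-length≤ {n} {r} t r≥1 common {D} D-dominating with t + 2 ≤? length (complement r D)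
... | no  short = s≤s⁻¹ (subst (length (complement r D) <_) (+-suc t 1) (≰⇒> short))
... | yes long  = contradiction (+-cancelˡ-≤ t 2 1 (subst (_≤ t + 1) (proj₂ taken) S-small)) λ { (s≤s ()) }
  where
  S : List (Subset n)
  S = take (t + 2) (complement r D)
  taken : IsVertexSet n r S × length S ≡ t + 2
  taken = vertexSet-take (t + 2) (complement-vertexSet r D) long
  S-small : length S ≤ t + 1
  S-small =
    let v , v-vertex , S-near = common S (proj₁ taken) (proj₂ taken) in
    undominated-closedNbhd-length≤ t r≥1 D-dominating (proj₁ taken)
      (λ u∈S → proj₂ (∈-complement⁻ (∈-take (t + 2) (complement r D) u∈S))) v-vertex S-near

isKTupleDom-length≥ : ∀ {n r} t → 1 ≤ r → HasCommonClosedNeighbours n r (t + 2) →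
  ∀ D → IsKTupleDom n r ((n ∸ r) C r ∸ t) D → length D ≥ n C r ∸ (t + 1)
isKTupleDom-length≥ {n} {r} t r≥1 common D D-dominating = m≤n+o⇒m∸n≤o (n C r) (t + 1) (begin
  n C r                              ≤⟨ vertices-length≥ (vertex-∈-++ {xs = complement r D} {ys = D} ∈-complement⁺) ⟩
  length (complement r D ++ D)       ≡⟨ length-++ (complement r D) ⟩
  length (complement r D) + length D ≤⟨ +-monoˡ-≤ (length D) (complement-length≤ t r≥1 common D-dominating) ⟩
  t + 1 + length D                   ∎)
  where open ≤-Reasoning

n∸k≤nC[1+k] : ∀ n k → k < n → n ∸ k ≤ n C suc k
n∸k≤nC[1+k] (suc n) zero    _         = ≤-reflexive (sym (nC1≡n (suc n)))
n∸k≤nC[1+k] (suc n) (suc k) (s≤s k<n) = ≤-trans (n∸k≤nC[1+k] n k k<n)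
  (subst (n C suc k ≤_) (nCk+nC[k+1]≡[n+1]C[k+1] n (suc k)) (m≤m+n _ _))

t+1≤nCr : ∀ t s n → (t + 3) * (2 + s) ≤ n + ⌈ (t + 2) /2⌉ → t + 1 ≤ n C (2 + s)
t+1≤nCr t s n room =
  ≤-trans (m+n≤o⇒m≤o∸n (t + 1) (subst (_≤ n) (sym (+-assoc t 1 (suc s))) t+r≤n))
          (n∸k≤nC[1+k] n (suc s) (≤-trans (m≤n+m (2 + s) t) t+r≤n))
  where
  open ≤-Reasoning
  t+r≤n : t + (2 + s) ≤ n
  t+r≤n = +-cancelʳ-≤ (t + 2) _ _ (begin
    t + (2 + s) + (t + 2)                     ≤⟨ m≤m+n _ (2 + (t + 2) * s) ⟩
    t + (2 + s) + (t + 2) + (2 + (t + 2) * s)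
      ≡⟨ solve 2 (λ t s → t :+ (con 2 :+ s) :+ (t :+ con 2) :+ (con 2 :+ (t :+ con 2) :* s)
                          := (t :+ con 3) :* (con 2 :+ s)) refl t s ⟩
    (t + 3) * (2 + s)                         ≤⟨ room ⟩
    n + ⌈ (t + 2) /2⌉                         ≤⟨ +-monoʳ-≤ n (⌈n/2⌉≤n (t + 2)) ⟩
    n + (t + 2)                               ∎)

theorem16 : (n r t : ℕ) → r ≥ 2 → n ≥ 2 * r + 1
    → n ≥ (t + 3) * r ∸ ⌈ (t + 2) /2⌉
    → let k = ((n ∸ r) C r) ∸ t
          γ = (n C r) ∸ (t + 1)
      in
      -- γ is attained ...
      (∃ λ (D : List (Subset n)) → IsKTupleDom n r k D × length D ≡ γ)
      -- ... and is minimal (so γ_{×k}(K(n,r)) = γ)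
      × (∀ (D : List (Subset n)) → IsKTupleDom n r k D → length D ≥ γ)
      -- moreover: for every S with |S| = t+1, V \ S is a minimum k-tuple dominating set
      × (∀ (S D : List (Subset n)) → IsVertexSet n r S → length S ≡ t + 1
           → (∀ (v : Subset n) → (v ∈ D) ⇔ (IsVertex r v × v ∉ S))
           → Unique D
           → IsKTupleDom n r k D × length D ≡ γ)
-- The hypothesis n ≥ 2r + 1 is implied by the other two.
theorem16 n r@(suc (suc s)) t (s≤s (s≤s z≤n)) _ n≥ =
  (complement r S , complement-isKTupleDom t r≥1 S (complement r S) (proj₁ S-taken) (proj₂ S-taken)
                      (λ _ → mk⇔ ∈-complement⁻ (uncurry ∈-complement⁺)) (proj₁ (complement-vertexSet r S))) ,
  isKTupleDom-length≥ t r≥1 common ,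
  complement-isKTupleDom t r≥1
  where
  r≥1 : 1 ≤ r
  r≥1 = s≤s z≤n
  room : (t + 3) * r ≤ n + ⌈ (t + 2) /2⌉
  room = ≤-trans (m≤n+m∸n _ ⌈ (t + 2) /2⌉) (≤-trans (+-monoʳ-≤ _ n≥) (≤-reflexive (+-comm _ n)))
  common : HasCommonClosedNeighbours n r (t + 2)
  common S S-vertexSet |S| = common-closed-neighbour r S (proj₂ S-vertexSet)
    (subst (λ m → (m + 1) * r ≤ n + ⌈ m /2⌉) (sym |S|)
      (subst (λ m → m * r ≤ n + ⌈ (t + 2) /2⌉) (sym (+-assoc t 2 1)) room))
  S : List (Subset n)
  S = take (t + 1) (vertices n r)
  S-taken : IsVertexSet n r S × length S ≡ t + 1
  S-taken = vertexSet-take (t + 1) (vertices-vertexSet n r)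
    (subst (t + 1 ≤_) (sym (length-vertices n r)) (t+1≤nCr t s n room))
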